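{- Fix $\ell^-\in\mathbb{N}_0$ and let $\pi,\sigma$ be partitions of the same size. Then $\pi\trianglelefteq_{\ell^- }\sigma$ in the $\ell^-$-twisted dominance order if and only if both (a) $\pi^-_1+\dots+\pi^-_i\le\sigma^-_1+\dots+\sigma^-_i$ for all $i$, and (b) $|\pi^+|\ge|\sigma^+|$ and $\pi^+\trianglelefteq\sigma^++(|\pi^+|-|\sigma^+|)$ in the dominance order.
   Context: The $\ell$-decomposition of a partition $\sigma$ is $\sigma^-=(\sigma'_1,\dots,\sigma'_\ell)$, $\sigma^+=\sigma-(\sigma^-)'$ ($'$ = conjugate). $\sigma^++(c)$ adds $c$ to the first part. The $\ell$-twisted dominance order: for partitions of the same size, $\pi\trianglelefteq_\ell\sigma$ iff every partial sum of $(\pi^-_1,\dots,\pi^-_\ell,\pi^+_1,\pi^+_2,\dots)$ is at most the corresponding partial sum of $(\sigma^-_1,\dots,\sigma^-_\ell,\sigma^+_1,\sigma^+_2,\dots)$. The dominance order on partitions of the same size compares partial sums. -}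

module Defs where

open import Data.Nat using (ℕ; zero; suc; _+_; _∸_; _≤_; _<_; _≤?_; _<?_; z≤n; s≤s)
open import Data.List using (List; []; _∷_; map; filter; length)
open import Data.Nat.ListAction using (sum)
open import Data.List.Relation.Unary.All using (All)
open import Data.List.Relation.Unary.Linked using (Linked)
open import Data.Product using (_×_)
open import Relation.Binary.PropositionalEquality using (_≡_)
open import Relation.Nullary.Decidable using (does)
open import Data.Bool using (if_then_else_)

IsPartition : List ℕ → Set
IsPartition λs = All (λ x → 1 ≤ x) λs × Linked (λ a b → b ≤ a) λs

-- i-th part, 0-indexed (part λ 0 = λ₁), zero beyond the length.
part : List ℕ → ℕ → ℕ
part []       _       = 0
part (x ∷ _)  zero    = x
part (_ ∷ xs) (suc i) = part xs i

oneTo : ℕ → List ℕ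
oneTo zero    = []
oneTo (suc n) = oneTo n Data.List.++ (suc n ∷ [])

range : ℕ → List ℕ
range zero    = []
range (suc n) = range n Data.List.++ (n ∷ [])

-- j-th part of the conjugate (1-indexed j): #{ i : λ_i ≥ j }
conjPart : List ℕ → ℕ → ℕ
conjPart λs j = length (filter (λ x → j ≤? x) λs)

conj : List ℕ → List ℕ
conj λs = map (conjPart λs) (oneTo (part λs 0))

-- σ⁻ = (σ'_1, ..., σ'_ℓ)   (exactly ℓ entries, possibly zero)
minusPart : ℕ → List ℕ → List ℕ
minusPart ℓ σ = map (conjPart σ) (oneTo ℓ)

-- σ⁺ = σ − (σ⁻)'  (componentwise; trailing zero entries are harmless)
plusPart : ℕ → List ℕ → List ℕ
plusPart ℓ σ = map (λ i → part σ i ∸ part (conj (minusPart ℓ σ)) i) (range (length σ))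

-- σ⁺ + (c): add c to the first part
addFirst : ℕ → List ℕ → List ℕ
addFirst c []       = c ∷ []
addFirst c (x ∷ xs) = (x + c) ∷ xs

psum : (ℕ → ℕ) → ℕ → ℕ
psum f zero    = 0
psum f (suc k) = psum f k + f k

_⊴_ : List ℕ → List ℕ → Set
μ ⊴ ν = sum μ ≡ sum ν × (∀ k → psum (part μ) k ≤ psum (part ν) k)

twistSeq : ℕ → List ℕ → ℕ → ℕ
twistSeq ℓ σ k = if does (k <? ℓ) then part (minusPart ℓ σ) k else part (plusPart ℓ σ) (k ∸ ℓ)

_⊴[_]_ : List ℕ → ℕ → List ℕ → Set
π ⊴[ ℓ ] σ = sum π ≡ sum σ × (∀ k → psum (twistSeq ℓ π) k ≤ psum (twistSeq ℓ σ) k)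

-- Each part splits as σᵢ = min(σᵢ, ℓ) + (σᵢ ∸ ℓ), and (σ⁻)' is exactly the partition
-- (min(σᵢ, ℓ))ᵢ, so |σ| = |σ⁻| + |σ⁺|.  The first ℓ twisted partial sums are those of σ⁻,
-- and the (ℓ + j)-th is |σ⁻| plus the j-th partial sum of σ⁺.  When |π| = |σ|, the condition
-- at ℓ says |π⁻| ≤ |σ⁻|, i.e. |π⁺| ≥ |σ⁺|, so |σ⁻| = |π⁻| + (|π⁺| − |σ⁺|); cancelling |π⁻|
-- from the later conditions leaves the dominance π⁺ ⊴ σ⁺ + (|π⁺| − |σ⁺|).

module Submission where

open import Defs
open import Data.Nat using (ℕ; zero; suc; _+_; _∸_; _⊓_; _≤_; _<_; _≥_; _≰_; _≤?_; _<?_; z≤n; s≤s)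
open import Data.Nat.Properties
open import Data.Nat.ListAction using (sum)
open import Data.Nat.ListAction.Properties using (sum-++)
open import Data.List using (List; []; _∷_; _++_; [_]; map; filter; length)
open import Data.List.Properties using (map-++; length-map; length-++; filter-accept; filter-reject; filter-all; filter-++)
open import Data.List.Relation.Unary.All using (All)
open import Data.List.Relation.Unary.Linked using (Linked; _∷_; tail)
open import Data.Bool using (if_then_else_)
open import Data.Product using (_×_; _,_)
open import Data.Sum using (inj₁; inj₂)
open import Relation.Unary using (Decidable)
open import Function.Bundles using (_⇔_; mk⇔; module Equivalence)
open import Relation.Binary.PropositionalEquality using (_≡_; refl; sym; trans; cong; cong₂; subst; subst₂; module ≡-Reasoning)
open import Relation.Nullary using (yes; no; contradiction)
open import Relation.Nullary.Decidable using (dec-true; dec-false)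
open import Algebra.Properties.CommutativeSemigroup +-commutativeSemigroup using (interchange; xy∙z≈xz∙y)

sum-map-∷ʳ : ∀ (f : ℕ → ℕ) xs x → sum (map f (xs ++ [ x ])) ≡ sum (map f xs) + f x
sum-map-∷ʳ f xs x = begin
  sum (map f (xs ++ [ x ]))   ≡⟨ cong sum (map-++ f xs [ x ]) ⟩
  sum (map f xs ++ [ f x ])   ≡⟨ sum-++ (map f xs) [ f x ] ⟩
  sum (map f xs) + (f x + 0)  ≡⟨ cong (sum (map f xs) +_) (+-identityʳ (f x)) ⟩
  sum (map f xs) + f x        ∎
  where open ≡-Reasoning

sum-map-range : ∀ (f : ℕ → ℕ) n → sum (map f (range n)) ≡ psum f n
sum-map-range f zero    = refl
sum-map-range f (suc n) = trans (sum-map-∷ʳ f (range n) n) (cong (_+ f n) (sum-map-range f n))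

length-oneTo : ∀ n → length (oneTo n) ≡ n
length-oneTo zero    = refl
length-oneTo (suc n) = trans (length-++ (oneTo n)) (trans (cong (_+ 1) (length-oneTo n)) (+-comm n 1))

part-++ˡ : ∀ xs ys {i} → i < length xs → part (xs ++ ys) i ≡ part xs i
part-++ˡ (x ∷ xs) ys {zero}  _         = refl
part-++ˡ (x ∷ xs) ys {suc i} (s≤s i<n) = part-++ˡ xs ys i<n

part-++-length : ∀ xs y ys → part (xs ++ y ∷ ys) (length xs) ≡ y
part-++-length []       y ys = refl
part-++-length (x ∷ xs) y ys = part-++-length xs y ys

part-oneTo : ∀ {n i} → i < n → part (oneTo n) i ≡ suc i
part-oneTo {suc n} {i} (s≤s i≤n) with m≤n⇒m<n∨m≡n i≤n
... | inj₁ i<n  = trans (part-++ˡ (oneTo n) [ suc n ] (subst (i <_) (sym (length-oneTo n)) i<n)) (part-oneTo i<n)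
... | inj₂ refl = trans (cong (part (oneTo (suc i))) (sym (length-oneTo i))) (part-++-length (oneTo i) (suc i) [])

part-map : ∀ (f : ℕ → ℕ) xs {i} → i < length xs → part (map f xs) i ≡ f (part xs i)
part-map f (x ∷ xs) {zero}  _         = refl
part-map f (x ∷ xs) {suc i} (s≤s i<n) = part-map f xs i<n

part-map-oneTo : ∀ (f : ℕ → ℕ) {n i} → i < n → part (map f (oneTo n)) i ≡ f (suc i)
part-map-oneTo f {n} i<n =
  trans (part-map f (oneTo n) (subst (_ <_) (sym (length-oneTo n)) i<n)) (cong f (part-oneTo i<n))

psum-shift : ∀ f k → psum f (suc k) ≡ f 0 + psum (λ i → f (suc i)) k
psum-shift f zero    = sym (+-identityʳ (f 0))
psum-shift f (suc k) = trans (cong (_+ f (suc k)) (psum-shift f k)) (+-assoc (f 0) _ _)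

psum-cong : ∀ {f g} k → (∀ i → i < k → f i ≡ g i) → psum f k ≡ psum g k
psum-cong zero    f≡g = refl
psum-cong (suc k) f≡g = cong₂ _+_ (psum-cong k (λ i i<k → f≡g i (m<n⇒m<1+n i<k))) (f≡g k (n<1+n k))

psum-zero : ∀ k → psum (λ _ → 0) k ≡ 0
psum-zero zero    = refl
psum-zero (suc k) = trans (+-identityʳ _) (psum-zero k)

psum-part : ∀ xs {k} → length xs ≤ k → psum (part xs) k ≡ sum xs
psum-part []       {k}     _         = psum-zero k
psum-part (x ∷ xs) {suc k} (s≤s n≤k) = trans (psum-shift (part (x ∷ xs)) k) (cong (x +_) (psum-part xs n≤k))

psum-map-part : ∀ (g : ℕ → ℕ) xs → psum (λ i → g (part xs i)) (length xs) ≡ sum (map g xs)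
psum-map-part g []       = refl
psum-map-part g (x ∷ xs) =
  trans (psum-shift (λ i → g (part (x ∷ xs) i)) (length xs)) (cong (g x +_) (psum-map-part g xs))

sum-addFirst : ∀ c xs → sum (addFirst c xs) ≡ sum xs + c
sum-addFirst c []       = +-identityʳ c
sum-addFirst c (x ∷ xs) = xy∙z≈xz∙y x c (sum xs)

psum-addFirst : ∀ c xs k → psum (part (addFirst c xs)) (suc k) ≡ psum (part xs) (suc k) + c
psum-addFirst c []       k = begin
  psum (part [ c ]) (suc k)   ≡⟨ psum-part [ c ] {suc k} (s≤s z≤n) ⟩
  c + 0                       ≡⟨ +-identityʳ c ⟩
  c                           ≡⟨ cong (_+ c) (psum-part [] {suc k} z≤n) ⟨
  psum (part []) (suc k) + c  ∎
  where open ≡-Reasoning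
psum-addFirst c (x ∷ xs) k = begin
  psum (part (x + c ∷ xs)) (suc k)  ≡⟨ psum-shift (part (x + c ∷ xs)) k ⟩
  x + c + psum (part xs) k          ≡⟨ xy∙z≈xz∙y x c (psum (part xs) k) ⟩
  x + psum (part xs) k + c          ≡⟨ cong (_+ c) (psum-shift (part (x ∷ xs)) k) ⟨
  psum (part (x ∷ xs)) (suc k) + c  ∎
  where open ≡-Reasoning

conjPart-∷-≤ : ∀ {x xs j} → j ≤ x → conjPart (x ∷ xs) j ≡ suc (conjPart xs j)
conjPart-∷-≤ {j = j} j≤x = cong length (filter-accept (j ≤?_) j≤x)

conjPart-∷-≰ : ∀ {x xs j} → j ≰ x → conjPart (x ∷ xs) j ≡ conjPart xs j
conjPart-∷-≰ {j = j} j≰x = cong length (filter-reject (j ≤?_) j≰x)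

conjPart-1 : ∀ {xs} → All (1 ≤_) xs → conjPart xs 1 ≡ length xs
conjPart-1 positive = cong length (filter-all (1 ≤?_) positive)

part-≤-head : ∀ {x xs} → Linked _≥_ (x ∷ xs) → ∀ i → part (x ∷ xs) i ≤ x
part-≤-head                _            zero    = ≤-refl
part-≤-head {xs = []}      _            (suc i) = z≤n
part-≤-head {xs = y ∷ ys} (x≥y ∷ y∷ys↘) (suc i) = ≤-trans (part-≤-head y∷ys↘ i) x≥y

<-conjPart⇒≤-part : ∀ {xs} → Linked _≥_ xs → ∀ {i j} → i < conjPart xs j → j ≤ part xs i
<-conjPart⇒≤-part {x ∷ xs} xs↘ {i} {j} i<c with j ≤? x
<-conjPart⇒≤-part {x ∷ xs} xs↘ {zero}   i<c | yes j≤x = j≤x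
<-conjPart⇒≤-part {x ∷ xs} xs↘ {suc i}  i<c | yes j≤x =
  <-conjPart⇒≤-part (tail xs↘) (≤-pred (subst (suc i <_) (conjPart-∷-≤ j≤x) i<c))
<-conjPart⇒≤-part {x ∷ xs} xs↘ {i} {j} i<c | no j≰x = contradiction
  (≤-trans (<-conjPart⇒≤-part (tail xs↘) (subst (i <_) (conjPart-∷-≰ j≰x) i<c)) (part-≤-head xs↘ (suc i))) j≰x

≤-part⇒<-conjPart : ∀ {xs} → Linked _≥_ xs → ∀ {i j} → i < length xs → j ≤ part xs i → i < conjPart xs j
≤-part⇒<-conjPart {x ∷ xs} xs↘ {i} {j} i<n j≤xᵢ with j ≤? x
≤-part⇒<-conjPart {x ∷ xs} xs↘ {zero}  _         _    | yes j≤x =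
  subst (0 <_) (sym (conjPart-∷-≤ j≤x)) (s≤s z≤n)
≤-part⇒<-conjPart {x ∷ xs} xs↘ {suc i} (s≤s i<n) j≤xᵢ | yes j≤x =
  subst (suc i <_) (sym (conjPart-∷-≤ j≤x)) (s≤s (≤-part⇒<-conjPart (tail xs↘) i<n j≤xᵢ))
≤-part⇒<-conjPart {x ∷ xs} xs↘ {i}     _         j≤xᵢ | no j≰x =
  contradiction (≤-trans j≤xᵢ (part-≤-head xs↘ i)) j≰x

⊓-suc-≥ : ∀ {m n} → suc n ≤ m → m ⊓ suc n ≡ suc (m ⊓ n)
⊓-suc-≥ {m} {n} n<m = trans (m≥n⇒m⊓n≡n n<m) (cong suc (sym (m≥n⇒m⊓n≡n (<⇒≤ n<m))))

⊓-suc-≰ : ∀ {m n} → suc n ≰ m → m ⊓ suc n ≡ m ⊓ n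
⊓-suc-≰ {m} {n} n≮m = trans (m≤n⇒m⊓n≡m (m≤n⇒m≤1+n m≤n)) (sym (m≤n⇒m⊓n≡m m≤n))
  where
  m≤n : m ≤ n
  m≤n = ≤-pred (≰⇒> n≮m)

module _ {P : ℕ → Set} (P? : Decidable P) (f : ℕ → ℕ) where

  length-filter-map-∷ʳ : ∀ xs x →
    length (filter P? (map f (xs ++ [ x ]))) ≡ length (filter P? (map f xs)) + length (filter P? [ f x ])
  length-filter-map-∷ʳ xs x = begin
    length (filter P? (map f (xs ++ [ x ])))                  ≡⟨ cong (λ ys → length (filter P? ys)) (map-++ f xs [ x ]) ⟩
    length (filter P? (map f xs ++ [ f x ]))                  ≡⟨ cong length (filter-++ P? (map f xs) [ f x ]) ⟩
    length (filter P? (map f xs) ++ filter P? [ f x ])        ≡⟨ length-++ (filter P? (map f xs)) ⟩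
    length (filter P? (map f xs)) + length (filter P? [ f x ]) ∎
    where open ≡-Reasoning

  length-filter-map-oneTo : ∀ v → (∀ j → P (f j) → j ≤ v) → (∀ j → j ≤ v → P (f j)) →
    ∀ n → length (filter P? (map f (oneTo n))) ≡ v ⊓ n
  length-filter-map-oneTo v _ _ zero = sym (⊓-zeroʳ v)
  length-filter-map-oneTo v P⇒≤ ≤⇒P (suc n) with suc n ≤? v
  ... | yes n<v = begin
    length (filter P? (map f (oneTo (suc n))))  ≡⟨ length-filter-map-∷ʳ (oneTo n) (suc n) ⟩
    length (filter P? (map f (oneTo n))) + length (filter P? [ f (suc n) ])  ≡⟨ cong₂ _+_ (length-filter-map-oneTo v P⇒≤ ≤⇒P n)
                                                             (cong length (filter-accept P? (≤⇒P (suc n) n<v))) ⟩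
    v ⊓ n + 1                                   ≡⟨ +-comm (v ⊓ n) 1 ⟩
    suc (v ⊓ n)                                 ≡⟨ ⊓-suc-≥ n<v ⟨
    v ⊓ suc n                                   ∎
    where open ≡-Reasoning
  ... | no n≮v = begin
    length (filter P? (map f (oneTo (suc n))))  ≡⟨ length-filter-map-∷ʳ (oneTo n) (suc n) ⟩
    length (filter P? (map f (oneTo n))) + length (filter P? [ f (suc n) ])  ≡⟨ cong₂ _+_ (length-filter-map-oneTo v P⇒≤ ≤⇒P n)
                                                             (cong length (filter-reject P? (λ p → n≮v (P⇒≤ (suc n) p)))) ⟩
    v ⊓ n + 0                                   ≡⟨ +-identityʳ (v ⊓ n) ⟩
    v ⊓ n                                       ≡⟨ ⊓-suc-≰ n≮v ⟨
    v ⊓ suc n                                   ∎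
    where open ≡-Reasoning

part-conj-minusPart : ∀ {xs} → IsPartition xs → ∀ ℓ {i} → i < length xs →
  part (conj (minusPart ℓ xs)) i ≡ part xs i ⊓ ℓ
part-conj-minusPart {xs} _                 zero    {i} _   = sym (⊓-zeroʳ (part xs i))
part-conj-minusPart {xs} (positive , xs↘) (suc ℓ) {i} i<n = begin
  part (conj xs⁻) i     ≡⟨ part-map-oneTo (conjPart xs⁻) (subst (i <_) (sym xs⁻₁≡n) i<n) ⟩
  conjPart xs⁻ (suc i)  ≡⟨ length-filter-map-oneTo (suc i ≤?_) (conjPart xs) (part xs i)
                             (λ _ → <-conjPart⇒≤-part xs↘) (λ _ → ≤-part⇒<-conjPart xs↘ i<n) (suc ℓ) ⟩
  part xs i ⊓ suc ℓ     ∎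
  where
  open ≡-Reasoning
  xs⁻ : List ℕ
  xs⁻ = minusPart (suc ℓ) xs
  xs⁻₁≡n : part xs⁻ 0 ≡ length xs
  xs⁻₁≡n = trans (part-map-oneTo (conjPart xs) {suc ℓ} (s≤s z≤n)) (conjPart-1 positive)

sum-map-⊓-zero : ∀ xs → sum (map (_⊓ 0) xs) ≡ 0
sum-map-⊓-zero []       = refl
sum-map-⊓-zero (x ∷ xs) = cong₂ _+_ (⊓-zeroʳ x) (sum-map-⊓-zero xs)

sum-map-⊓-suc : ∀ xs n → sum (map (_⊓ suc n) xs) ≡ sum (map (_⊓ n) xs) + conjPart xs (suc n)
sum-map-⊓-suc []       n = refl
sum-map-⊓-suc (x ∷ xs) n with suc n ≤? x
... | yes n<x = begin
  x ⊓ suc n + sum (map (_⊓ suc n) xs)  ≡⟨ cong₂ _+_ (⊓-suc-≥ n<x) (sum-map-⊓-suc xs n) ⟩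
  suc (x ⊓ n) + (S + C)                ≡⟨ cong suc (+-assoc (x ⊓ n) S C) ⟨
  suc (x ⊓ n + S + C)                  ≡⟨ +-suc (x ⊓ n + S) C ⟨
  x ⊓ n + S + suc C                    ≡⟨ cong (x ⊓ n + S +_) (conjPart-∷-≤ n<x) ⟨
  x ⊓ n + S + conjPart (x ∷ xs) (suc n) ∎
  where
  open ≡-Reasoning
  S C : ℕ
  S = sum (map (_⊓ n) xs)
  C = conjPart xs (suc n)
... | no n≮x = begin
  x ⊓ suc n + sum (map (_⊓ suc n) xs)  ≡⟨ cong₂ _+_ (⊓-suc-≰ n≮x) (sum-map-⊓-suc xs n) ⟩
  x ⊓ n + (S + C)                      ≡⟨ +-assoc (x ⊓ n) S C ⟨
  x ⊓ n + S + C                        ≡⟨ cong (x ⊓ n + S +_) (conjPart-∷-≰ n≮x) ⟨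
  x ⊓ n + S + conjPart (x ∷ xs) (suc n) ∎
  where
  open ≡-Reasoning
  S C : ℕ
  S = sum (map (_⊓ n) xs)
  C = conjPart xs (suc n)

sum-minusPart : ∀ ℓ xs → sum (minusPart ℓ xs) ≡ sum (map (_⊓ ℓ) xs)
sum-minusPart zero    xs = sym (sum-map-⊓-zero xs)
sum-minusPart (suc ℓ) xs = begin
  sum (map (conjPart xs) (oneTo ℓ ++ [ suc ℓ ]))  ≡⟨ sum-map-∷ʳ (conjPart xs) (oneTo ℓ) (suc ℓ) ⟩
  sum (minusPart ℓ xs) + conjPart xs (suc ℓ)      ≡⟨ cong (_+ conjPart xs (suc ℓ)) (sum-minusPart ℓ xs) ⟩
  sum (map (_⊓ ℓ) xs) + conjPart xs (suc ℓ)       ≡⟨ sum-map-⊓-suc xs ℓ ⟨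
  sum (map (_⊓ suc ℓ) xs)                         ∎
  where open ≡-Reasoning

m∸m⊓n≡m∸n : ∀ m n → m ∸ m ⊓ n ≡ m ∸ n
m∸m⊓n≡m∸n zero    n       = sym (0∸n≡0 n)
m∸m⊓n≡m∸n (suc m) zero    = refl
m∸m⊓n≡m∸n (suc m) (suc n) = m∸m⊓n≡m∸n m n

sum-plusPart : ∀ {xs} → IsPartition xs → ∀ ℓ → sum (plusPart ℓ xs) ≡ sum (map (_∸ ℓ) xs)
sum-plusPart {xs} xs-partition ℓ = begin
  sum (plusPart ℓ xs)                                                  ≡⟨ sum-map-range _ (length xs) ⟩
  psum (λ i → part xs i ∸ part (conj (minusPart ℓ xs)) i) (length xs)  ≡⟨ psum-cong (length xs) part-plusPart ⟩
  psum (λ i → part xs i ∸ ℓ) (length xs)                               ≡⟨ psum-map-part (_∸ ℓ) xs ⟩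
  sum (map (_∸ ℓ) xs)                                                  ∎
  where
  open ≡-Reasoning
  part-plusPart : ∀ i → i < length xs → part xs i ∸ part (conj (minusPart ℓ xs)) i ≡ part xs i ∸ ℓ
  part-plusPart i i<n = trans (cong (part xs i ∸_) (part-conj-minusPart xs-partition ℓ i<n)) (m∸m⊓n≡m∸n (part xs i) ℓ)

sum-map-⊓+sum-map-∸ : ∀ ℓ xs → sum (map (_⊓ ℓ) xs) + sum (map (_∸ ℓ) xs) ≡ sum xs
sum-map-⊓+sum-map-∸ ℓ []       = refl
sum-map-⊓+sum-map-∸ ℓ (x ∷ xs) = begin
  (x ⊓ ℓ + sum (map (_⊓ ℓ) xs)) + ((x ∸ ℓ) + sum (map (_∸ ℓ) xs))  ≡⟨ interchange (x ⊓ ℓ) _ (x ∸ ℓ) _ ⟩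
  (x ⊓ ℓ + (x ∸ ℓ)) + (sum (map (_⊓ ℓ) xs) + sum (map (_∸ ℓ) xs))  ≡⟨ cong₂ _+_ x⊓ℓ+x∸ℓ≡x (sum-map-⊓+sum-map-∸ ℓ xs) ⟩
  x + sum xs                                                          ∎
  where
  open ≡-Reasoning
  x⊓ℓ+x∸ℓ≡x : x ⊓ ℓ + (x ∸ ℓ) ≡ x
  x⊓ℓ+x∸ℓ≡x = trans (cong (_+ (x ∸ ℓ)) (⊓-comm x ℓ)) (m⊓n+n∸m≡n ℓ x)

sum-minusPart+sum-plusPart : ∀ {xs} → IsPartition xs → ∀ ℓ → sum (minusPart ℓ xs) + sum (plusPart ℓ xs) ≡ sum xs
sum-minusPart+sum-plusPart {xs} xs-partition ℓ =
  trans (cong₂ _+_ (sum-minusPart ℓ xs) (sum-plusPart xs-partition ℓ)) (sum-map-⊓+sum-map-∸ ℓ xs)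

elim-≤-or-+ : ∀ {P : ℕ → Set} ℓ → (∀ k → k ≤ ℓ → P k) → (∀ j → P (ℓ + j)) → ∀ k → P k
elim-≤-or-+ {P} ℓ below above k with ≤-total k ℓ
... | inj₁ k≤ℓ = below k k≤ℓ
... | inj₂ ℓ≤k = subst P (m+[n∸m]≡n ℓ≤k) (above (k ∸ ℓ))

length-minusPart : ∀ ℓ xs → length (minusPart ℓ xs) ≡ ℓ
length-minusPart ℓ xs = trans (length-map (conjPart xs) (oneTo ℓ)) (length-oneTo ℓ)

psum-minusPart-≥ : ∀ ℓ xs {k} → ℓ ≤ k → psum (part (minusPart ℓ xs)) k ≡ sum (minusPart ℓ xs)
psum-minusPart-≥ ℓ xs ℓ≤k = psum-part (minusPart ℓ xs) (subst (_≤ _) (sym (length-minusPart ℓ xs)) ℓ≤k)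

twistSeq-< : ∀ ℓ xs {k} → k < ℓ → twistSeq ℓ xs k ≡ part (minusPart ℓ xs) k
twistSeq-< ℓ xs {k} k<ℓ =
  cong (λ b → if b then part (minusPart ℓ xs) k else part (plusPart ℓ xs) (k ∸ ℓ)) (dec-true (k <? ℓ) k<ℓ)

twistSeq-+ : ∀ ℓ xs j → twistSeq ℓ xs (ℓ + j) ≡ part (plusPart ℓ xs) j
twistSeq-+ ℓ xs j = begin
  twistSeq ℓ xs (ℓ + j)
    ≡⟨ cong (λ b → if b then part (minusPart ℓ xs) (ℓ + j) else part (plusPart ℓ xs) (ℓ + j ∸ ℓ))
            (dec-false (ℓ + j <? ℓ) (m+n≮m ℓ j)) ⟩
  part (plusPart ℓ xs) (ℓ + j ∸ ℓ)
    ≡⟨ cong (part (plusPart ℓ xs)) (m+n∸m≡n ℓ j) ⟩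
  part (plusPart ℓ xs) j
    ∎
  where open ≡-Reasoning

psum-twistSeq-≤ : ∀ ℓ xs {k} → k ≤ ℓ → psum (twistSeq ℓ xs) k ≡ psum (part (minusPart ℓ xs)) k
psum-twistSeq-≤ ℓ xs {zero}  _   = refl
psum-twistSeq-≤ ℓ xs {suc k} k<ℓ = cong₂ _+_ (psum-twistSeq-≤ ℓ xs (<⇒≤ k<ℓ)) (twistSeq-< ℓ xs k<ℓ)

psum-twistSeq-+ : ∀ ℓ xs j → psum (twistSeq ℓ xs) (ℓ + j) ≡ sum (minusPart ℓ xs) + psum (part (plusPart ℓ xs)) j
psum-twistSeq-+ ℓ xs zero = begin
  psum (twistSeq ℓ xs) (ℓ + 0)        ≡⟨ cong (psum (twistSeq ℓ xs)) (+-identityʳ ℓ) ⟩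
  psum (twistSeq ℓ xs) ℓ              ≡⟨ psum-twistSeq-≤ ℓ xs ≤-refl ⟩
  psum (part (minusPart ℓ xs)) ℓ      ≡⟨ psum-minusPart-≥ ℓ xs ≤-refl ⟩
  sum (minusPart ℓ xs)                ≡⟨ +-identityʳ _ ⟨
  sum (minusPart ℓ xs) + 0            ∎
  where open ≡-Reasoning
psum-twistSeq-+ ℓ xs (suc j) = begin
  psum (twistSeq ℓ xs) (ℓ + suc j)
    ≡⟨ cong (psum (twistSeq ℓ xs)) (+-suc ℓ j) ⟩
  psum (twistSeq ℓ xs) (ℓ + j) + twistSeq ℓ xs (ℓ + j)
    ≡⟨ cong₂ _+_ (psum-twistSeq-+ ℓ xs j) (twistSeq-+ ℓ xs j) ⟩
  sum (minusPart ℓ xs) + psum (part (plusPart ℓ xs)) j + part (plusPart ℓ xs) j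
    ≡⟨ +-assoc (sum (minusPart ℓ xs)) _ _ ⟩
  sum (minusPart ℓ xs) + psum (part (plusPart ℓ xs)) (suc j)
    ∎
  where open ≡-Reasoning

twisted-psums-⇔ : ∀ ℓ π σ →
  (∀ k → psum (twistSeq ℓ π) k ≤ psum (twistSeq ℓ σ) k) ⇔
  ((∀ i → psum (part (minusPart ℓ π)) i ≤ psum (part (minusPart ℓ σ)) i) ×
   (∀ j → sum (minusPart ℓ π) + psum (part (plusPart ℓ π)) j ≤ sum (minusPart ℓ σ) + psum (part (plusPart ℓ σ)) j))
twisted-psums-⇔ ℓ π σ = mk⇔
  (λ twisted → elim-≤-or-+ ℓ (minus-below twisted) (minus-above twisted) , plus twisted)
  (λ (minus , plus) → elim-≤-or-+ ℓ
    (λ k k≤ℓ → subst₂ _≤_ (sym (psum-twistSeq-≤ ℓ π k≤ℓ)) (sym (psum-twistSeq-≤ ℓ σ k≤ℓ)) (minus k))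
    (λ j → subst₂ _≤_ (sym (psum-twistSeq-+ ℓ π j)) (sym (psum-twistSeq-+ ℓ σ j)) (plus j)))
  where
  Twisted : Set
  Twisted = ∀ k → psum (twistSeq ℓ π) k ≤ psum (twistSeq ℓ σ) k
  minus-below : Twisted → ∀ k → k ≤ ℓ → psum (part (minusPart ℓ π)) k ≤ psum (part (minusPart ℓ σ)) k
  minus-below twisted k k≤ℓ = subst₂ _≤_ (psum-twistSeq-≤ ℓ π k≤ℓ) (psum-twistSeq-≤ ℓ σ k≤ℓ) (twisted k)
  minus-above : Twisted → ∀ j → psum (part (minusPart ℓ π)) (ℓ + j) ≤ psum (part (minusPart ℓ σ)) (ℓ + j)
  minus-above twisted j = subst₂ _≤_
    (trans (psum-minusPart-≥ ℓ π ≤-refl) (sym (psum-minusPart-≥ ℓ π (m≤m+n ℓ j))))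
    (trans (psum-minusPart-≥ ℓ σ ≤-refl) (sym (psum-minusPart-≥ ℓ σ (m≤m+n ℓ j))))
    (minus-below twisted ℓ ≤-refl)
  plus : Twisted → ∀ j →
    sum (minusPart ℓ π) + psum (part (plusPart ℓ π)) j ≤ sum (minusPart ℓ σ) + psum (part (plusPart ℓ σ)) j
  plus twisted j = subst₂ _≤_ (psum-twistSeq-+ ℓ π j) (psum-twistSeq-+ ℓ σ j) (twisted (ℓ + j))

shifted-psums-⇔ : ∀ {s s′} (p p′ : List ℕ) → s + sum p ≡ s′ + sum p′ →
  (∀ j → s + psum (part p) j ≤ s′ + psum (part p′) j) ⇔
  (sum p′ ≤ sum p × p ⊴ addFirst (sum p ∸ sum p′) p′)
shifted-psums-⇔ {s} {s′} p p′ total = mk⇔ to from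
  where
  T T′ : ℕ
  T = sum p
  T′ = sum p′
  P P′ : ℕ → ℕ
  P = psum (part p)
  P′ = psum (part p′)

  s′≡s+excess : T′ ≤ T → s′ ≡ s + (T ∸ T′)
  s′≡s+excess T′≤T = +-cancelʳ-≡ T′ s′ (s + (T ∸ T′)) (begin
    s′ + T′             ≡⟨ total ⟨
    s + T               ≡⟨ cong (s +_) (m∸n+n≡m T′≤T) ⟨
    s + (T ∸ T′ + T′)   ≡⟨ +-assoc s (T ∸ T′) T′ ⟨
    s + (T ∸ T′) + T′   ∎)
    where open ≡-Reasoning

  regroup : ∀ d y → s + d + y ≡ s + (y + d)
  regroup d y = trans (+-assoc s d y) (cong (s +_) (+-comm d y))

  to : (∀ j → s + P j ≤ s′ + P′ j) → T′ ≤ T × p ⊴ addFirst (T ∸ T′) p′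
  to shifted = T′≤T , sym (trans (sum-addFirst d p′) (m+[n∸m]≡n T′≤T)) , dominated
    where
    s≤s′ : s ≤ s′
    s≤s′ = subst₂ _≤_ (+-identityʳ s) (+-identityʳ s′) (shifted 0)
    T′≤T : T′ ≤ T
    T′≤T = +-cancelˡ-≤ s′ T′ T (subst (_≤ s′ + T) total (+-monoˡ-≤ T s≤s′))
    d : ℕ
    d = T ∸ T′
    dominated : ∀ k → P k ≤ psum (part (addFirst d p′)) k
    dominated zero    = z≤n
    dominated (suc k) = subst (P (suc k) ≤_) (sym (psum-addFirst d p′ k)) (+-cancelˡ-≤ s _ _
      (subst (s + P (suc k) ≤_) (trans (cong (_+ P′ (suc k)) (s′≡s+excess T′≤T)) (regroup d (P′ (suc k))))
             (shifted (suc k))))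

  from : T′ ≤ T × p ⊴ addFirst (T ∸ T′) p′ → ∀ j → s + P j ≤ s′ + P′ j
  from (T′≤T , _ , dominated) j =
    subst (s + P j ≤_) (trans (sym (regroup d (P′ j))) (cong (_+ P′ j) (sym (s′≡s+excess T′≤T))))
          (+-monoʳ-≤ s (excess j))
    where
    d : ℕ
    d = T ∸ T′
    excess : ∀ j → P j ≤ P′ j + d
    excess zero    = z≤n
    excess (suc k) = subst (P (suc k) ≤_) (psum-addFirst d p′ k) (dominated (suc k))

lemma6p7 : (ℓ : ℕ) (π σ : List ℕ) → IsPartition π → IsPartition σ → sum π ≡ sum σ →
    (π ⊴[ ℓ ] σ) ⇔
      ((∀ i → psum (part (minusPart ℓ π)) i ≤ psum (part (minusPart ℓ σ)) i)
       × (sum (plusPart ℓ σ) ≤ sum (plusPart ℓ π)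
          × (plusPart ℓ π ⊴ addFirst (sum (plusPart ℓ π) ∸ sum (plusPart ℓ σ)) (plusPart ℓ σ))))
lemma6p7 ℓ π σ π-partition σ-partition |π|≡|σ| = mk⇔
  (λ (_ , twisted) → let minus , plus = to (twisted-psums-⇔ ℓ π σ) twisted
                     in minus , to (shifted-psums-⇔ π⁺ σ⁺ sizes) plus)
  (λ (minus , plus) → |π|≡|σ| , from (twisted-psums-⇔ ℓ π σ) (minus , from (shifted-psums-⇔ π⁺ σ⁺ sizes) plus))
  where
  open Equivalence
  π⁺ σ⁺ : List ℕ
  π⁺ = plusPart ℓ π
  σ⁺ = plusPart ℓ σ
  sizes : sum (minusPart ℓ π) + sum π⁺ ≡ sum (minusPart ℓ σ) + sum σ⁺
  sizes = trans (sum-minusPart+sum-plusPart π-partition ℓ)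
         (trans |π|≡|σ| (sym (sum-minusPart+sum-plusPart σ-partition ℓ)))
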